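{- Let $n\ge 3$ and let $\Gamma_1$ and $\Gamma_2$ be marked $n$-trees. If there is a contraction $\Gamma_1\to\Gamma_2$, then it is unique. Consequently, contracting two different subforests of the same $n$-tree (each subforest consisting of subtrees that each contain at most one marked vertex) must result in different $n$-trees.
   Context: A tree is a finite, contractible, $1$-dimensional simplicial complex; connected subcomplexes are subtrees, and a collection of disjoint subtrees is a subforest. For an integer $n\ge 3$, a marked $n$-tree (or $n$-tree) is a tree $\Gamma$ together with distinct marked vertices $v_1,\dots,v_n$, such that every vertex of valence $1$ or $2$ is marked. The remaining vertices are unmarked and unlabeled. If $\Gamma_1,\Gamma_2$ are $n$-trees with marked vertices $v_1,\dots,v_n$, a contraction $f\colon\Gamma_1\to\Gamma_2$ is a surjective cellular map such that for every $i$, $f^{ -1}(v_i)$ is a subtree of $\Gamma_1$ containing $v_i$. Contractions are regarded up to isotopy within each edge. Equivalently, a contraction is obtained by choosing a collection of disjoint subtrees, each containing at most one marked vertex, and collapsing each to a point. -}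

module Defs where

open import Data.Nat using (ℕ; _≤_)
open import Data.Fin using (Fin)
open import Data.Bool using (Bool; true; false)
open import Data.List using (List; []; _∷_; length; filterᵇ; allFin)
open import Data.List.Relation.Unary.All using (All)
open import Data.List.Relation.Unary.Unique.Propositional using (Unique)
open import Data.Product using (Σ; ∃; _×_)
open import Data.Sum using (_⊎_)
open import Relation.Binary.PropositionalEquality using (_≡_)
open import Function.Definitions using (Injective)

-- A finite simple graph on vertex set Fin V is given by a Boolean adjacency
-- relation (required symmetric and irreflexive below).

data Walk {V : ℕ} (E : Fin V → Fin V → Bool) : Fin V → Fin V → List (Fin V) → Set where
  stop : (v : Fin V) → Walk E v v (v ∷ [])
  step : {u w v : Fin V} {xs : List (Fin V)} →
         E u w ≡ true → Walk E w v xs → Walk E u v (u ∷ xs)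

Path : {V : ℕ} → (Fin V → Fin V → Bool) → Fin V → Fin V → List (Fin V) → Set
Path E u v xs = Walk E u v xs × Unique xs

-- A tree (finite contractible 1-dim simplicial complex) = a graph in which
-- any two vertices are joined by exactly one simple path.
IsTree : {V : ℕ} → (Fin V → Fin V → Bool) → Set
IsTree {V} E =
  ((u v : Fin V) → ∃ λ xs → Path E u v xs) ×
  ((u v : Fin V) (xs ys : List (Fin V)) → Path E u v xs → Path E u v ys → xs ≡ ys)

valence : {V : ℕ} → (Fin V → Fin V → Bool) → Fin V → ℕ
valence {V} E v = length (filterᵇ (E v) (allFin V))

record NTree (n : ℕ) : Set where
  field
    V      : ℕ
    adj    : Fin V → Fin V → Bool
    symm   : (a b : Fin V) → adj a b ≡ adj b a
    irrefl : (a : Fin V) → adj a a ≡ false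
    tree   : IsTree adj
    mark   : Fin n → Fin V
    mark-injective : Injective _≡_ _≡_ mark
    lowValence-marked : (v : Fin V) → 1 ≤ valence adj v → valence adj v ≤ 2 →
                        ∃ λ i → mark i ≡ v

open NTree public

-- A contraction Γ₁ → Γ₂, described combinatorially (up to isotopy in edges)
-- by its vertex map f: the fibres of f are subtrees (connected subsets) of
-- Γ₁, marked vertices go to the corresponding marked vertices, each edge of
-- Γ₁ is either collapsed or sent to an edge of Γ₂, and f is surjective on
-- vertices and on edges.
record Contraction {n : ℕ} (Γ₁ Γ₂ : NTree n) : Set where
  field
    fun : Fin (V Γ₁) → Fin (V Γ₂)
    surj-vertices : (w : Fin (V Γ₂)) → ∃ λ a → fun a ≡ w
    marks : (i : Fin n) → fun (mark Γ₁ i) ≡ mark Γ₂ i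
    cellular : (a b : Fin (V Γ₁)) → adj Γ₁ a b ≡ true →
               (fun a ≡ fun b) ⊎ (adj Γ₂ (fun a) (fun b) ≡ true)
    surj-edges : (x y : Fin (V Γ₂)) → adj Γ₂ x y ≡ true →
                 ∃ λ a → ∃ λ b → adj Γ₁ a b ≡ true × fun a ≡ x × fun b ≡ y
    fibre-connected : (a b : Fin (V Γ₁)) → fun a ≡ fun b →
                      ∃ λ xs → Walk (adj Γ₁) a b xs × All (λ x → fun x ≡ fun a) xs

open Contraction public

record NTreeIso {n : ℕ} (Δ₁ Δ₂ : NTree n) : Set where
  field
    to   : Fin (V Δ₁) → Fin (V Δ₂)
    from : Fin (V Δ₂) → Fin (V Δ₁)
    from-to : (a : Fin (V Δ₁)) → from (to a) ≡ a
    to-from : (b : Fin (V Δ₂)) → to (from b) ≡ b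
    adj-pres : (a b : Fin (V Δ₁)) → adj Δ₂ (to a) (to b) ≡ adj Δ₁ a b
    mark-pres : (i : Fin n) → to (mark Δ₁ i) ≡ mark Δ₂ i

-- The subforest collapsed by a contraction is its set of collapsed edges.
SameCollapsedEdges : {n : ℕ} {Γ Δ₁ Δ₂ : NTree n} →
                     Contraction Γ Δ₁ → Contraction Γ Δ₂ → Set
SameCollapsedEdges {Γ = Γ} c d =
  (a b : Fin (V Γ)) → adj Γ a b ≡ true →
  ((fun c a ≡ fun c b) → (fun d a ≡ fun d b)) ×
  ((fun d a ≡ fun d b) → (fun c a ≡ fun c b))

-- An unmarked vertex v of an n-tree has valence at least 3.  Leaving v along
-- three different edges and walking outwards, never turning back, one must
-- stop at a marked vertex, since every leaf is marked; so v is the median of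
-- three marked vertices, i.e. it lies on all three paths between them.  A
-- contraction maps the path between two vertices into the path between their
-- images, so it sends v to a median of the corresponding marked vertices of
-- the target, and medians in a tree are unique.  Thus any contraction is
-- determined by the marking.  Composing with an isomorphism Δ₁ ≅ Δ₂ turns a
-- contraction Γ → Δ₁ into one Γ → Δ₂, which gives the second statement.
module Submission where

open import Defs
open import Data.Nat using (ℕ; zero; suc; s≤s; _+_; _≤_; _<_; _≤?_)
open import Data.Nat.Properties using (≰⇒>; <⇒≱; +-assoc; +-identityʳ; m≤n+m)
open import Data.Fin using (Fin)
import Data.Fin.Properties as Fin
open import Data.Bool using (Bool; true; false)
open import Data.Bool.Properties using (T-≡)
open import Data.List using (List; []; _∷_; _++_; [_]; _∷ʳ_; reverse; length; lookup; filterᵇ; allFin)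
open import Data.List.Properties using (unfold-reverse; ∷ʳ-++; ∷-injective; length-++)
open import Data.List.Relation.Unary.All as All using (All; []; _∷_)
import Data.List.Relation.Unary.All.Properties as All
open import Data.List.Relation.Unary.Any as Any using (here; there)
import Data.List.Relation.Unary.Any.Properties as Any
open import Data.List.Relation.Unary.AllPairs using ([]; _∷_)
open import Data.List.Relation.Unary.Unique.Propositional using (Unique)
import Data.List.Relation.Unary.Unique.Propositional.Properties as Unique
open import Data.List.Relation.Binary.Disjoint.Propositional using (Disjoint)
open import Data.List.Relation.Binary.Subset.Propositional using (_⊆_)
open import Data.List.Membership.Propositional using (_∈_; _∉_)
open import Data.List.Membership.Propositional.Properties using (∈-++⁺ˡ; ∈-++⁺ʳ; ∈-++⁻; ∈-filter⁺; ∈-filter⁻; ∈-lookup; ∈-allFin; ∈-length)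
open import Data.Product using (∃; ∃₂; _×_; _,_; proj₁; proj₂)
open import Data.Sum as Sum using (_⊎_; inj₁; inj₂)
open import Data.Empty using (⊥-elim)
open import Function using (_∘_)
open import Function.Bundles using (Equivalence)
open import Relation.Nullary using (¬_; Dec; yes; no)
open import Relation.Nullary.Decidable using (T?)
open import Relation.Binary.PropositionalEquality using (_≡_; _≢_; refl; sym; trans; cong; subst; subst₂)

module _ {A : Set} where

  Unique-++⁻ : ∀ (xs : List A) {ys} → Unique (xs ++ ys) →
               Unique xs × Unique ys × Disjoint xs ys
  Unique-++⁻ []       u          = [] , u , λ { (() , _) }
  Unique-++⁻ (x ∷ xs) (x∉ ∷ u) with Unique-++⁻ xs u
  ... | uxs , uys , disjoint =
    All.++⁻ˡ xs x∉ ∷ uxs , uys , λ where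
      (here refl , x∈ys) → All.lookup x∉ (∈-++⁺ʳ xs x∈ys) refl
      (there z∈xs , z∈ys) → disjoint (z∈xs , z∈ys)

  Unique-split : ∀ (pre : List A) {y post} → Unique (pre ++ y ∷ post) →
                 Unique (pre ∷ʳ y) × Unique (y ∷ post)
  Unique-split pre {y} {post} u =
    proj₁ (Unique-++⁻ (pre ∷ʳ y) (subst Unique (sym (∷ʳ-++ pre y post)) u)) ,
    proj₁ (proj₂ (Unique-++⁻ pre u))

  Unique-reverse : ∀ {xs : List A} → Unique xs → Unique (reverse xs)
  Unique-reverse {[]}     []       = []
  Unique-reverse {x ∷ xs} (x∉ ∷ u) =
    subst Unique (sym (unfold-reverse x xs))
      (Unique.++⁺ (Unique-reverse u) ([] ∷ [])
        λ { (x∈ , here refl) → All.lookup x∉ (Any.reverse⁻ x∈) refl })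

  Unique-lookup-injective : ∀ {xs : List A} → Unique xs →
                            ∀ i j → lookup xs i ≡ lookup xs j → i ≡ j
  Unique-lookup-injective (x∉ ∷ u) Fin.zero    Fin.zero    eq = refl
  Unique-lookup-injective (x∉ ∷ u) Fin.zero    (Fin.suc j) eq = ⊥-elim (All.lookup x∉ (∈-lookup j) eq)
  Unique-lookup-injective (x∉ ∷ u) (Fin.suc i) Fin.zero    eq = ⊥-elim (All.lookup x∉ (∈-lookup i) (sym eq))
  Unique-lookup-injective (x∉ ∷ u) (Fin.suc i) (Fin.suc j) eq = cong Fin.suc (Unique-lookup-injective u i j eq)

three-distinct : ∀ {A : Set} {xs : List A} → 3 ≤ length xs → Unique xs →
                 ∃ λ a → ∃ λ b → ∃ λ c → a ∈ xs × b ∈ xs × c ∈ xs × a ≢ b × b ≢ c × a ≢ c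
three-distinct {xs = []}             ()                _
three-distinct {xs = _ ∷ []}         (s≤s ())          _
three-distinct {xs = _ ∷ _ ∷ []}     (s≤s (s≤s ()))    _
three-distinct {xs = a ∷ b ∷ c ∷ _} _ ((a≢b ∷ a≢c ∷ _) ∷ (b≢c ∷ _) ∷ _) =
  a , b , c , here refl , there (here refl) , there (there (here refl)) , a≢b , b≢c , a≢c

Unique⇒length≤ : ∀ {N} {xs : List (Fin N)} → Unique xs → length xs ≤ N
Unique⇒length≤ {N} {xs} u with length xs ≤? N
... | yes ≤N = ≤N
... | no ≰N with Fin.pigeonhole (≰⇒> ≰N) (lookup xs)
... | i , j , i<j , eq = ⊥-elim (Fin.<⇒≢ i<j (Unique-lookup-injective u i j eq))

module Walks {N : ℕ} (E : Fin N → Fin N → Bool) where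

  walk-head : ∀ {a b xs} → Walk E a b xs → ∃ λ ys → xs ≡ a ∷ ys
  walk-head (stop _)   = _ , refl
  walk-head (step _ _) = _ , refl

  walk-first-edge : ∀ {a b xs} → Walk E a b xs → b ≢ a →
                    ∃₂ λ m ys → xs ≡ a ∷ m ∷ ys × E a m ≡ true
  walk-first-edge (stop _)   b≢a = ⊥-elim (b≢a refl)
  walk-first-edge (step e w) _ with walk-head w
  ... | ys , refl = _ , ys , refl , e

  _++ᵂ_ : ∀ {a m b xs ys} → Walk E a m xs → Walk E m b (m ∷ ys) → Walk E a b (xs ++ ys)
  stop _    ++ᵂ w₂ = w₂
  step e w₁ ++ᵂ w₂ = step e (w₁ ++ᵂ w₂)

  reverseᵂ : (∀ a b → E a b ≡ E b a) → ∀ {a b xs} → Walk E a b xs → Walk E b a (reverse xs)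
  reverseᵂ E-sym (stop v) = stop v
  reverseᵂ E-sym (step {u} {w} {xs = xs} e W) =
    subst (Walk E _ _) (sym (unfold-reverse u xs))
      (reverseᵂ E-sym W ++ᵂ step (trans (E-sym w u) e) (stop u))

  splitᵂ : ∀ {a b xs y} → Walk E a b xs → y ∈ xs →
           ∃₂ λ pre post → xs ≡ pre ++ y ∷ post × Walk E a y (pre ∷ʳ y) × Walk E y b (y ∷ post)
  splitᵂ (stop v)   (here refl) = [] , [] , refl , stop v , stop v
  splitᵂ (step e W) (here refl) = [] , _ , refl , stop _ , step e W
  splitᵂ (step {u} e W) (there y∈) with splitᵂ W y∈
  ... | pre , post , eq , w₁ , w₂ = u ∷ pre , post , cong (u ∷_) eq , step e w₁ , w₂

  splitᴾ : ∀ {a b xs y} → Path E a b xs → y ∈ xs →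
           ∃₂ λ pre post → xs ≡ pre ++ y ∷ post × Path E a y (pre ∷ʳ y) × Path E y b (y ∷ post)
  splitᴾ (w , u) y∈ with splitᵂ w y∈
  ... | pre , post , refl , w₁ , w₂ with Unique-split pre u
  ... | u₁ , u₂ = pre , post , refl , (w₁ , u₁) , (w₂ , u₂)

  walk⇒path : ∀ {a b xs} → Walk E a b xs → ∃ λ ps → Path E a b ps × ps ⊆ xs
  walk⇒path (stop v) = [ v ] , (stop v , [] ∷ []) , λ v∈ → v∈
  walk⇒path (step {u} e W) with walk⇒path W
  ... | ps , (w , uniq) , ps⊆ with Any.any? (u Fin.≟_) ps
  ... | no u∉ = u ∷ ps , (step e w , All.¬Any⇒All¬ ps u∉ ∷ uniq) ,
                λ { (here eq) → here eq ; (there z∈) → there (ps⊆ z∈) }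
  ... | yes u∈ with splitᴾ (w , uniq) u∈
  ... | pre , post , refl , _ , path₂ = u ∷ post , path₂ , λ z∈ → there (ps⊆ (∈-++⁺ʳ pre z∈))

module Trees {N : ℕ} (E : Fin N → Fin N → Bool)
             (E-sym : ∀ a b → E a b ≡ E b a) (E-irrefl : ∀ a → E a a ≡ false)
             (tree : IsTree E) where
  open Walks E public

  path : Fin N → Fin N → List (Fin N)
  path u v = proj₁ (proj₁ tree u v)

  path-isPath : ∀ u v → Path E u v (path u v)
  path-isPath u v = proj₂ (proj₁ tree u v)

  path-unique : ∀ {u v xs} → Path E u v xs → xs ≡ path u v
  path-unique {u} {v} p = proj₂ tree u v _ _ p (path-isPath u v)

  edge-≢ : ∀ {a b} → E a b ≡ true → a ≢ b
  edge-≢ {a} e refl with trans (sym e) (E-irrefl a)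
  ... | ()

  edge-path : ∀ {a b} → E a b ≡ true → path a b ≡ a ∷ b ∷ []
  edge-path e = sym (path-unique (step e (stop _) , (edge-≢ e ∷ []) ∷ [] ∷ []))

  path-reverse : ∀ u v → path v u ≡ reverse (path u v)
  path-reverse u v with path-isPath u v
  ... | w , uniq = sym (path-unique (reverseᵂ E-sym w , Unique-reverse uniq))

  ∈-path-sym : ∀ {x u v} → x ∈ path u v → x ∈ path v u
  ∈-path-sym {u = u} {v} x∈ = subst (_ ∈_) (sym (path-reverse u v)) (Any.reverse⁺ x∈)

  path⊆walk : ∀ {a b xs} → Walk E a b xs → path a b ⊆ xs
  path⊆walk w z∈ with walk⇒path w
  ... | _ , p , ps⊆ = ps⊆ (subst (_ ∈_) (sym (path-unique p)) z∈)

  path-split : ∀ {x y z} → z ∈ path x y → ∃₂ λ pre post →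
               path x y ≡ pre ++ z ∷ post × path x z ≡ pre ∷ʳ z × path z y ≡ z ∷ post
  path-split {x} {y} z∈ with splitᴾ (path-isPath x y) z∈
  ... | pre , post , eq , p₁ , p₂ = pre , post , eq , sym (path-unique p₁) , sym (path-unique p₂)

  path-prefix : ∀ {x y z} → z ∈ path x y → ∃ λ post → path x y ≡ path x z ++ post
  path-prefix z∈ with path-split z∈
  ... | pre , post , eq₁ , eq₂ , _ =
    post , trans eq₁ (trans (sym (∷ʳ-++ pre _ post)) (cong (_++ post) (sym eq₂)))

  path-split-disjoint : ∀ {x y z z'} → z ∈ path x y → z' ∈ path x z → z' ∈ path z y → z' ≡ z
  path-split-disjoint {x} {y} z∈ z'∈₁ z'∈₂ with path-split z∈
  ... | pre , post , eq₁ , eq₂ , eq₃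
    with ∈-++⁻ pre (subst (_ ∈_) eq₂ z'∈₁) | subst (_ ∈_) eq₃ z'∈₂
  ... | inj₂ (here eq) | _         = eq
  ... | inj₁ _         | here eq   = eq
  ... | inj₁ ∈pre      | there ∈post =
    ⊥-elim (proj₂ (proj₂ (Unique-++⁻ pre (subst Unique eq₁ (proj₂ (path-isPath x y)))))
                   (∈pre , there ∈post))

  path-split-cover : ∀ {x y z z'} → z ∈ path x y → z' ∈ path x y → z' ≢ z →
                     z' ∈ path x z ⊎ z' ∈ path z y
  path-split-cover z∈ z'∈ z'≢z with path-split z∈
  ... | pre , post , eq₁ , eq₂ , eq₃ with ∈-++⁻ pre (subst (_ ∈_) eq₁ z'∈)
  ... | inj₁ ∈pre         = inj₁ (subst (_ ∈_) (sym eq₂) (∈-++⁺ˡ ∈pre))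
  ... | inj₂ (here eq)    = ⊥-elim (z'≢z eq)
  ... | inj₂ (there ∈post) = inj₂ (subst (_ ∈_) (sym eq₃) (there ∈post))

  IsMedian : Fin N → Fin N → Fin N → Fin N → Set
  IsMedian x y u z = z ∈ path x y × z ∈ path y u × z ∈ path x u

  median-unique : ∀ {x y u z z'} → IsMedian x y u z → IsMedian x y u z' → z ≡ z'
  median-unique {z = z} {z'} (h₁ , h₂ , h₃) (g₁ , g₂ , g₃) with z' Fin.≟ z
  ... | yes eq = sym eq
  ... | no z'≢z
    with path-split-cover h₁ g₁ z'≢z | path-split-cover h₂ g₂ z'≢z | path-split-cover h₃ g₃ z'≢z
  ... | inj₁ a | inj₁ b | _      = ⊥-elim (z'≢z (path-split-disjoint h₁ a (∈-path-sym b)))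
  ... | inj₁ a | inj₂ b | _      = ⊥-elim (z'≢z (path-split-disjoint h₃ a b))
  ... | inj₂ a | _      | inj₁ b = ⊥-elim (z'≢z (path-split-disjoint h₁ b a))
  ... | inj₂ a | _      | inj₂ b = ⊥-elim (z'≢z (path-split-disjoint h₂ (∈-path-sym a) b))

  Departs : Fin N → Fin N → Fin N → Set
  Departs v n x = ∃ λ s → path v x ≡ v ∷ n ∷ s

  departs-functional : ∀ {v n₁ n₂ x} → Departs v n₁ x → Departs v n₂ x → n₁ ≡ n₂
  departs-functional (_ , eq₁) (_ , eq₂) = proj₁ (∷-injective (proj₂ (∷-injective (trans (sym eq₁) eq₂))))

  departs-∈ : ∀ {v n x z} → Departs v n x → z ∈ path v x → z ≢ v → Departs v n z
  departs-∈ {v} {z = z} (s , eq) z∈ z≢v with path-prefix z∈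
  ... | post , eq' with walk-first-edge (proj₁ (path-isPath v z)) z≢v
  ... | m , ys , eqz , _ with trans (sym eq) (trans eq' (cong (_++ post) eqz))
  ... | refl = ys , eqz

  neighbour-∈-path : ∀ {x a v} → E x a ≡ true → a ∈ path x v → Departs x a v
  neighbour-∈-path {x} {a} e a∈ with path-prefix a∈
  ... | post , eq = post , trans eq (cong (_++ post) (edge-path e))

  at-most-one-neighbour-on-path : ∀ {v x a b} → E x a ≡ true → E x b ≡ true → a ≢ b →
                                  a ∉ path v x ⊎ b ∉ path v x
  at-most-one-neighbour-on-path {v} {x} {a} {b} ea eb a≢b
    with Any.any? (a Fin.≟_) (path v x) | Any.any? (b Fin.≟_) (path v x)
  ... | no a∉ | _     = inj₁ a∉
  ... | yes _ | no b∉ = inj₂ b∉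
  ... | yes a∈ | yes b∈
    with neighbour-∈-path ea (∈-path-sym a∈) | neighbour-∈-path eb (∈-path-sym b∈)
  ... | d₁ | d₂ = ⊥-elim (a≢b (departs-functional d₁ d₂))

  path-extend : ∀ {v x a} → E x a ≡ true → a ∉ path v x → path v a ≡ path v x ∷ʳ a
  path-extend {v} {x} e a∉ with path-isPath v x
  ... | w , uniq = sym (path-unique (w ++ᵂ step e (stop _) ,
                         Unique.++⁺ uniq ([] ∷ []) λ { (a∈ , here refl) → a∉ a∈ }))

  departs-extend : ∀ {v n x a} → E x a ≡ true → a ∉ path v x → Departs v n x → Departs v n a
  departs-extend e a∉ (s , eq) = s ∷ʳ _ , trans (path-extend e a∉) (cong (_∷ʳ _) eq)

  -- reverse (path v x) ++ tail (path v y) is a path: a common vertex other than v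
  -- would be reached from v both through n₁ and through n₂.
  departs-apart⇒∈-path : ∀ {v n₁ n₂ x y} → Departs v n₁ x → Departs v n₂ y → n₁ ≢ n₂ →
                         v ∈ path x y
  departs-apart⇒∈-path {v} {n₁} {n₂} {x} {y} d₁ d₂@(r₂ , eq₂) n₁≢n₂
    with path-isPath v x | subst (Path E v y) eq₂ (path-isPath v y)
  ... | w₁ , uniq₁ | w₂ , v∉ ∷ uniq₂ =
    subst (v ∈_) (path-unique (reverseᵂ E-sym w₁ ++ᵂ w₂ ,
                               Unique.++⁺ (Unique-reverse uniq₁) uniq₂ disjoint))
      (∈-++⁺ˡ (Any.reverse⁺ (subst (v ∈_) (sym (proj₂ d₁)) (here refl))))
    where
    disjoint : Disjoint (reverse (path v x)) (n₂ ∷ r₂)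
    disjoint {z} (z∈₁ , z∈₂) with z Fin.≟ v
    ... | yes refl = All.lookup v∉ z∈₂ refl
    ... | no z≢v   = n₁≢n₂ (departs-functional (departs-∈ d₁ (Any.reverse⁻ z∈₁) z≢v)
                                               (departs-∈ d₂ (subst (z ∈_) (sym eq₂) (there z∈₂)) z≢v))

module NTrees {n : ℕ} (Γ : NTree n) where
  open Trees (adj Γ) (symm Γ) (irrefl Γ) (tree Γ) public

  Marked : Fin (V Γ) → Set
  Marked v = ∃ λ i → mark Γ i ≡ v

  marked? : ∀ v → Dec (Marked v)
  marked? v = Fin.any? (λ i → mark Γ i Fin.≟ v)

  neighbours : Fin (V Γ) → List (Fin (V Γ))
  neighbours y = filterᵇ (adj Γ y) (allFin (V Γ))

  ∈-neighbours⁻ : ∀ {y z} → z ∈ neighbours y → adj Γ y z ≡ true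
  ∈-neighbours⁻ {y} z∈ = Equivalence.to T-≡ (proj₂ (∈-filter⁻ (T? ∘ adj Γ y) {xs = allFin (V Γ)} z∈))

  ∈-neighbours⁺ : ∀ {y z} → adj Γ y z ≡ true → z ∈ neighbours y
  ∈-neighbours⁺ {y} {z} e = ∈-filter⁺ (T? ∘ adj Γ y) (∈-allFin z) (Equivalence.from T-≡ e)

  Unique-neighbours : ∀ y → Unique (neighbours y)
  Unique-neighbours y = Unique.filter⁺ (T? ∘ adj Γ y) (Unique.allFin⁺ (V Γ))

  unmarked-valence≥3 : Fin n → ∀ y → ¬ Marked y → 3 ≤ valence (adj Γ) y
  unmarked-valence≥3 i₀ y unmarked with valence (adj Γ) y ≤? 2
  ... | no ≰2 = ≰⇒> ≰2
  ... | yes ≤2 with walk-first-edge (proj₁ (path-isPath y (mark Γ i₀))) (λ eq → unmarked (i₀ , eq))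
  ... | _ , _ , _ , e = ⊥-elim (unmarked (lowValence-marked Γ y (∈-length (∈-neighbours⁺ e)) ≤2))

  unmarked-three-neighbours : Fin n → ∀ y → ¬ Marked y →
    ∃ λ a → ∃ λ b → ∃ λ c → adj Γ y a ≡ true × adj Γ y b ≡ true × adj Γ y c ≡ true ×
                            a ≢ b × b ≢ c × a ≢ c
  unmarked-three-neighbours i₀ y unmarked
    with three-distinct (unmarked-valence≥3 i₀ y unmarked) (Unique-neighbours y)
  ... | a , b , c , a∈ , b∈ , c∈ , distinct =
    a , b , c , ∈-neighbours⁻ a∈ , ∈-neighbours⁻ b∈ , ∈-neighbours⁻ c∈ , distinct

  unmarked-neighbour-off-path : Fin n → ∀ {v x} → ¬ Marked x →
                                ∃ λ a → adj Γ x a ≡ true × a ∉ path v x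
  unmarked-neighbour-off-path i₀ {v} {x} unmarked with unmarked-three-neighbours i₀ x unmarked
  ... | a , b , _ , ea , eb , _ , a≢b , _ with at-most-one-neighbour-on-path {v} ea eb a≢b
  ... | inj₁ a∉ = a , ea , a∉
  ... | inj₂ b∉ = b , eb , b∉

  -- k is fuel: each step lengthens path v x, which has at most V Γ vertices.
  reach-marked : Fin n → ∀ k {v nb x} → V Γ < length (path v x) + k → Departs v nb x →
                 ∃ λ i → Departs v nb (mark Γ i)
  reach-marked i₀ zero {v} {x = x} V< _ =
    ⊥-elim (<⇒≱ (subst (V Γ <_) (+-identityʳ _) V<) (Unique⇒length≤ (proj₂ (path-isPath v x))))
  reach-marked i₀ (suc k) {v} {x = x} V< d with marked? x
  ... | yes (i , refl) = i , d
  ... | no unmarked with unmarked-neighbour-off-path i₀ {v} unmarked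
  ... | a , e , a∉ = reach-marked i₀ k (subst (V Γ <_) (sym longer) V<) (departs-extend e a∉ d)
    where
    longer : length (path v a) + k ≡ length (path v x) + suc k
    longer = trans (cong (λ p → length p + k) (path-extend e a∉))
                   (trans (cong (_+ k) (length-++ (path v x))) (+-assoc (length (path v x)) 1 k))

  edge-reaches-mark : Fin n → ∀ {v a} → adj Γ v a ≡ true → ∃ λ i → Departs v a (mark Γ i)
  edge-reaches-mark i₀ e = reach-marked i₀ (suc (V Γ)) (m≤n+m (suc (V Γ)) _) ([] , edge-path e)

  unmarked-median : Fin n → ∀ v → ¬ Marked v →
                    ∃ λ i → ∃ λ j → ∃ λ k → IsMedian (mark Γ i) (mark Γ j) (mark Γ k) v
  unmarked-median i₀ v unmarked with unmarked-three-neighbours i₀ v unmarked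
  ... | a , b , c , ea , eb , ec , a≢b , b≢c , a≢c
    with edge-reaches-mark i₀ ea | edge-reaches-mark i₀ eb | edge-reaches-mark i₀ ec
  ... | i , dᵢ | j , dⱼ | k , dₖ =
    i , j , k , departs-apart⇒∈-path dᵢ dⱼ a≢b , departs-apart⇒∈-path dⱼ dₖ b≢c ,
    departs-apart⇒∈-path dᵢ dₖ a≢c

module Contractions {n : ℕ} {Γ₁ Γ₂ : NTree n} (c : Contraction Γ₁ Γ₂) where
  private
    module T₁ = NTrees Γ₁
    module T₂ = NTrees Γ₂

  lift-walk : ∀ {x y ys} → Walk (adj Γ₂) x y ys → ∀ {a b} → fun c a ≡ x → fun c b ≡ y →
         ∃ λ zs → Walk (adj Γ₁) a b zs × All (λ z → fun c z ∈ ys) zs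
  lift-walk (stop x) {a} {b} fa≡x fb≡x with fibre-connected c a b (trans fa≡x (sym fb≡x))
  ... | zs , w , fibre = zs , w , All.map (λ e → here (trans e fa≡x)) fibre
  lift-walk (step {u} {w} e W) {a} fa≡u fb≡y with surj-edges c u w e
  ... | a' , b' , e' , fa'≡u , fb'≡w
    with fibre-connected c a a' (trans fa≡u (sym fa'≡u)) | lift-walk W fb'≡w fb≡y
  ... | zs₁ , w₁ , fibre | zs₂ , w₂ , into =
    zs₁ ++ zs₂ , w₁ T₁.++ᵂ step e' w₂ ,
    All.++⁺ (All.map (λ e → here (trans e fa≡u)) fibre) (All.map there into)

  map-∈-path : ∀ {v a b} → v ∈ T₁.path a b → fun c v ∈ T₂.path (fun c a) (fun c b)
  map-∈-path {v} {a} {b} v∈ with lift-walk (proj₁ (T₂.path-isPath (fun c a) (fun c b))) refl refl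
  ... | _ , w , into = All.lookup into (T₁.path⊆walk w v∈)

  map-median : ∀ {i j k v} → T₁.IsMedian (mark Γ₁ i) (mark Γ₁ j) (mark Γ₁ k) v →
               T₂.IsMedian (mark Γ₂ i) (mark Γ₂ j) (mark Γ₂ k) (fun c v)
  map-median (h₁ , h₂ , h₃) = map-∈-marks h₁ , map-∈-marks h₂ , map-∈-marks h₃
    where
    map-∈-marks : ∀ {v i j} → v ∈ T₁.path (mark Γ₁ i) (mark Γ₁ j) →
                  fun c v ∈ T₂.path (mark Γ₂ i) (mark Γ₂ j)
    map-∈-marks {v} {i} {j} v∈ =
      subst₂ (λ s t → fun c v ∈ T₂.path s t) (marks c i) (marks c j) (map-∈-path v∈)

contraction-unique : ∀ {n} → Fin n → {Γ₁ Γ₂ : NTree n} (c d : Contraction Γ₁ Γ₂) →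
                     ∀ v → fun c v ≡ fun d v
contraction-unique i₀ {Γ₁} {Γ₂} c d v with NTrees.marked? Γ₁ v
... | yes (i , refl) = trans (marks c i) (sym (marks d i))
... | no unmarked with NTrees.unmarked-median Γ₁ i₀ v unmarked
... | _ , _ , _ , median =
  NTrees.median-unique Γ₂ (Contractions.map-median c median) (Contractions.map-median d median)

NTreeIso-to-injective : ∀ {n} {Δ₁ Δ₂ : NTree n} (φ : NTreeIso Δ₁ Δ₂) →
                        ∀ {x y} → NTreeIso.to φ x ≡ NTreeIso.to φ y → x ≡ y
NTreeIso-to-injective φ {x} {y} e = trans (sym (from-to x)) (trans (cong from e) (from-to y))
  where open NTreeIso φ

iso∘contraction : ∀ {n} {Γ Δ₁ Δ₂ : NTree n} → NTreeIso Δ₁ Δ₂ → Contraction Γ Δ₁ → Contraction Γ Δ₂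
iso∘contraction {Δ₂ = Δ₂} φ c = record
  { fun = to ∘ fun c
  ; surj-vertices = λ w → let (a , fa≡) = surj-vertices c (from w) in
                          a , trans (cong to fa≡) (to-from w)
  ; marks = λ i → trans (cong to (marks c i)) (mark-pres i)
  ; cellular = λ a b e → Sum.map (cong to) (trans (adj-pres (fun c a) (fun c b))) (cellular c a b e)
  ; surj-edges = λ x y e →
      let (a , b , e' , fa≡ , fb≡) = surj-edges c (from x) (from y) (trans (sym (adj-pres (from x) (from y)))
                (subst₂ (λ s t → adj Δ₂ s t ≡ true) (sym (to-from x)) (sym (to-from y)) e))
      in a , b , e' , trans (cong to fa≡) (to-from x) , trans (cong to fb≡) (to-from y)
  ; fibre-connected = λ a b e → let (zs , w , fibre) = fibre-connected c a b (NTreeIso-to-injective φ e)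
                                in zs , w , All.map (cong to) fibre
  }
  where open NTreeIso φ

isomorphic-contractions-same-fibres : ∀ {n} → Fin n → {Γ Δ₁ Δ₂ : NTree n} →
  NTreeIso Δ₁ Δ₂ → (c : Contraction Γ Δ₁) (d : Contraction Γ Δ₂) →
  ∀ a b → (fun c a ≡ fun c b → fun d a ≡ fun d b) × (fun d a ≡ fun d b → fun c a ≡ fun c b)
isomorphic-contractions-same-fibres i₀ φ c d a b =
  (λ e → trans (sym (φc≡d a)) (trans (cong to e) (φc≡d b))) ,
  (λ e → NTreeIso-to-injective φ (trans (φc≡d a) (trans e (sym (φc≡d b)))))
  where
  open NTreeIso φ
  φc≡d : ∀ x → to (fun c x) ≡ fun d x
  φc≡d = contraction-unique i₀ (iso∘contraction φ c) d

lemma2p4 : (n : ℕ) → 3 ≤ n →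
    ((Γ₁ Γ₂ : NTree n) (c d : Contraction Γ₁ Γ₂) → (v : Fin (V Γ₁)) → fun c v ≡ fun d v)
    ×
    ((Γ Δ₁ Δ₂ : NTree n) (c : Contraction Γ Δ₁) (d : Contraction Γ Δ₂) → NTreeIso Δ₁ Δ₂ →
    SameCollapsedEdges c d)
lemma2p4 zero ()
lemma2p4 (suc n) _ =
  (λ _ _ → contraction-unique Fin.zero) ,
  (λ _ _ _ c d φ a b _ → isomorphic-contractions-same-fibres Fin.zero φ c d a b)
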